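{- Let $U$ be a universe with $|U|=n=2^w-1$. Let $\pi_{t-1}$ be a permutation of $U$, let $p_{t-1}=\mathrm{cp}(\pi_{t-1})$, let $p_t$ be any valid partitioning of $U$, and let $R_t\subseteq U$ be nonempty. Then there exists a permutation $\pi_t$ of $U$ with $\mathrm{cp}(\pi_t)=p_t$ such that $$\min_{x\in R_t}\pi_{t-1}(x)+d(\pi_{t-1},\pi_t)\;\le\;4\cdot\Big(\min_{x\in R_t}\mathrm{size}(p_{t-1},x)+\sum_{x:\,p_t(x)\neq p_{t-1}(x)}\max\{\mathrm{size}(p_{t-1},x),\mathrm{size}(p_t,x)\}\Big).$$
   Context: A permutation of $U$ is a bijection $\pi:U\to\{1,\dots,n\}$; $d(\pi,\pi')$ is the number of pairs of elements ordered differently in $\pi$ and $\pi'$ (the minimum number of adjacent swaps turning one into the other). With $[w]=\{0,\dots,w-1\}$, a partitioning $p:U\to[w]$ is valid if $|p^{ -1}(i)|=2^i$ for every $i$, and $\mathrm{size}(p,x)=2^{p(x)}$. The canonic partitioning of a permutation $\pi$ is $\mathrm{cp}(\pi)(x)=\lfloor\log_2\pi(x)\rfloor$ (a valid partitioning when $n=2^w-1$). The left side is the cost in step $t$ of an MSSC algorithm moving from $\pi_{t-1}$ to $\pi_t$ on request $R_t$, and the parenthesized right side is the cost in step $t$ of an Exponential Caching algorithm moving from $p_{t-1}$ to $p_t$ on request $R_t$. -}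

module Defs where

open import Data.Nat using (ℕ; zero; suc; _+_; _*_; _^_; _⊔_; _⊓_; _<_; _<?_)
open import Data.Nat.Logarithm using (⌊log₂_⌋)
import Data.Fin
open import Data.Fin using (Fin; toℕ; _≟_)
open import Data.Fin.Subset using (Subset; _∈_)
open import Data.Bool using (Bool; true; false; if_then_else_; _∧_)
open import Data.Vec using (Vec; lookup; _∷_)
open import Data.Maybe using (Maybe; just; nothing)
open import Data.Product using (Σ; _×_; _,_)
open import Data.Sum using (_⊎_)
open import Function.Bundles using (Bijection; _⤖_)
open import Relation.Binary.PropositionalEquality using (_≡_)
open import Relation.Nullary.Decidable using (⌊_⌋; does)
open import Relation.Nullary using (Dec)

-- The universe U is Fin n.  A permutation π : U → {1,…,n} is represented
-- by a bijection σ : Fin n → Fin n with π(x) = toℕ (σ x) + 1.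
Perm : ℕ → Set
Perm n = Fin n ⤖ Fin n

rank : ∀ {n} → Perm n → Fin n → ℕ
rank π x = suc (toℕ (Bijection.to π x))

Σ[_]_ : (n : ℕ) → (Fin n → ℕ) → ℕ
Σ[ zero ] f = 0
Σ[ suc n ] f = f Data.Fin.zero + Σ[ n ] (λ i → f (Data.Fin.suc i))

count : ∀ {n} → (P : Fin n → Bool) → ℕ
count {n} P = Σ[ n ] (λ x → if P x then 1 else 0)

-- Kendall tau distance: number of pairs {x,y} ordered differently.
-- Counted over ordered pairs (x,y) with π x < π y and π' y < π' x;
-- each unordered discordant pair is counted exactly once this way.
discordant : ∀ {n} → Perm n → Perm n → Fin n → Fin n → Bool
discordant π π' x y =
  does (rank π x <? rank π y) ∧ does (rank π' y <? rank π' x)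

dist : ∀ {n} → Perm n → Perm n → ℕ
dist {n} π π' = Σ[ n ] (λ x → Σ[ n ] (λ y → if discordant π π' x y then 1 else 0))

Partitioning : ℕ → ℕ → Set
Partitioning n w = Fin n → Fin w

Valid : ∀ {n w} → Partitioning n w → Set
Valid {n} {w} p = (i : Fin w) → count (λ x → does (p x ≟ i)) ≡ 2 ^ toℕ i

size : ∀ {n w} → Partitioning n w → Fin n → ℕ
size p x = 2 ^ toℕ (p x)

cpℕ : ∀ {n} → Perm n → Fin n → ℕ
cpℕ π x = ⌊log₂ rank π x ⌋

-- minimum of f over a subset R (returns nothing iff R is empty)
minOver : ∀ {n} → Subset n → (Fin n → ℕ) → Maybe ℕ
minOver {zero} R f = nothing
minOver {suc n} (b ∷ R) f = combine b (minOver R (λ i → f (Data.Fin.suc i)))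
  where
  combine : Bool → Maybe ℕ → Maybe ℕ
  combine true  nothing  = just (f Data.Fin.zero)
  combine false nothing  = nothing
  combine true  (just m) = just (f Data.Fin.zero ⊓ m)
  combine false (just m) = just m

moveCost : ∀ {n w} → Partitioning n w → Partitioning n w → ℕ
moveCost {n} p p' =
  Σ[ n ] (λ x → if does (p' x ≟ p x) then 0 else (size p x ⊔ size p' x))

module Submission where

open import Defs
open import Data.Nat
open import Data.Nat.Properties
open import Data.Nat.Logarithm
open import Data.Bool using (Bool; true; false; if_then_else_; _∧_; not; T)
open import Data.Bool.Properties using (T-∧)
open import Data.Empty using (⊥-elim)
open import Data.Unit using (tt)
open import Data.Fin as F using (Fin; toℕ; fromℕ<)
import Data.Fin.Properties as FP
open import Data.Fin.Subset using (Subset; _∈_; Nonempty)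
open import Data.Vec using (_∷_; here; there)
open import Data.Maybe using (just; nothing)
open import Data.Maybe.Properties using (just-injective)
open import Data.Product using (Σ; _×_; _,_; ∃; proj₁; proj₂)
open import Data.Sum as Sum using (_⊎_; inj₁; inj₂; [_,_])
open import Function using (_∘_; _⇔_; Equivalence)
open import Function.Bundles using (Bijection; mk⤖; mk⇔)
open import Function.Definitions using (Injective; StrictlySurjective)
open import Function.Consequences.Propositional using (strictlySurjective⇒surjective)
open import Relation.Binary using (tri<; tri≈; tri>)
open import Relation.Binary.PropositionalEquality
  using (_≡_; refl; sym; trans; cong; cong₂; subst; subst₂; module ≡-Reasoning)
open import Relation.Nullary using (¬_; Dec; yes; no)
open import Relation.Nullary.Decidable using (decidable-stable; does)
open import Relation.Nullary.Negation using (contradiction)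
open import Algebra.Properties.Semiring.Sum +-*-semiring
  using (sum; ∑-distrib-+; ∑-comm; *-distribˡ-sum; sum-replicate-zero; sum-cong-≗)

-- Take π₁ to sort U by the new level p₁(x), ties broken by π₀. Since p₁ is valid, the elements
-- of level < k fill exactly the first 2^k − 1 positions, so cp(π₁) = p₁. If a pair x, y is
-- inverted (x before y in π₀, after y in π₁), then p₁(y) < p₁(x). Charge it to x when x moved:
-- at most 2^p₁(x) − 1 pairs. Otherwise p₁(x) = p₀(x) ≤ p₀(y) (cp(π₀) = p₀ is monotone), so y
-- moved and the pair is charged to y: at most 2^(p₀(y)+1) − 1 pairs. Hence d(π₀,π₁) is at most
-- 3 Σ_moved max(size p₀ x, size p₁ x), while min π₀ < 2 · min size p₀ because cp(π₀) = p₀.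

Σ≡sum : ∀ n (f : Fin n → ℕ) → Σ[ n ] f ≡ sum f
Σ≡sum zero    f = refl
Σ≡sum (suc n) f = cong (f F.zero +_) (Σ≡sum n (f ∘ F.suc))

Σ-cong : ∀ n {f g : Fin n → ℕ} → (∀ i → f i ≡ g i) → Σ[ n ] f ≡ Σ[ n ] g
Σ-cong n {f} {g} f≗g = trans (Σ≡sum n f) (trans (sum-cong-≗ f≗g) (sym (Σ≡sum n g)))

Σ-distrib-+ : ∀ n (f g : Fin n → ℕ) → Σ[ n ] (λ i → f i + g i) ≡ Σ[ n ] f + Σ[ n ] g
Σ-distrib-+ n f g = begin
  Σ[ n ] (λ i → f i + g i) ≡⟨ Σ≡sum n _ ⟩
  sum (λ i → f i + g i)    ≡⟨ ∑-distrib-+ f g ⟩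
  sum f + sum g            ≡⟨ cong₂ _+_ (Σ≡sum n f) (Σ≡sum n g) ⟨
  Σ[ n ] f + Σ[ n ] g      ∎
  where open ≡-Reasoning

Σ-comm : ∀ m n (f : Fin m → Fin n → ℕ) →
         Σ[ m ] (λ i → Σ[ n ] (f i)) ≡ Σ[ n ] (λ j → Σ[ m ] (λ i → f i j))
Σ-comm m n f = begin
  Σ[ m ] (λ i → Σ[ n ] (f i))          ≡⟨ Σ≡sum m _ ⟩
  sum (λ i → Σ[ n ] (f i))             ≡⟨ sum-cong-≗ (λ i → Σ≡sum n (f i)) ⟩
  sum (λ i → sum (f i))                ≡⟨ ∑-comm f ⟩
  sum (λ j → sum (λ i → f i j))        ≡⟨ sum-cong-≗ (λ j → Σ≡sum m (λ i → f i j)) ⟨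
  sum (λ j → Σ[ m ] (λ i → f i j))     ≡⟨ Σ≡sum n _ ⟨
  Σ[ n ] (λ j → Σ[ m ] (λ i → f i j))  ∎
  where open ≡-Reasoning

*-distribˡ-Σ : ∀ n k (f : Fin n → ℕ) → k * Σ[ n ] f ≡ Σ[ n ] (λ i → k * f i)
*-distribˡ-Σ n k f = begin
  k * Σ[ n ] f             ≡⟨ cong (k *_) (Σ≡sum n f) ⟩
  k * sum f                ≡⟨ *-distribˡ-sum k f ⟩
  sum (λ i → k * f i)      ≡⟨ Σ≡sum n _ ⟨
  Σ[ n ] (λ i → k * f i)   ∎
  where open ≡-Reasoning

Σ-zero : ∀ n → Σ[ n ] (λ _ → 0) ≡ 0
Σ-zero n = trans (Σ≡sum n _) (sum-replicate-zero n)

Σ-mono-≤ : ∀ n {f g : Fin n → ℕ} → (∀ i → f i ≤ g i) → Σ[ n ] f ≤ Σ[ n ] g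
Σ-mono-≤ zero    f≤g = z≤n
Σ-mono-≤ (suc n) f≤g = +-mono-≤ (f≤g F.zero) (Σ-mono-≤ n (f≤g ∘ F.suc))

Σ-mono-< : ∀ n {f g : Fin n → ℕ} → (∀ i → f i ≤ g i) → ∀ j → f j < g j → Σ[ n ] f < Σ[ n ] g
Σ-mono-< (suc n) f≤g F.zero    fj<gj = +-mono-<-≤ fj<gj (Σ-mono-≤ n (f≤g ∘ F.suc))
Σ-mono-< (suc n) f≤g (F.suc j) fj<gj = +-mono-≤-< (f≤g F.zero) (Σ-mono-< n (f≤g ∘ F.suc) j fj<gj)

does-sound : ∀ {a} {A : Set a} (a? : Dec A) → T (does a?) → A
does-sound (yes a) _ = a

does-complete : ∀ {a} {A : Set a} (a? : Dec A) → A → T (does a?)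
does-complete (yes _) _ = tt
does-complete (no ¬a) a = ¬a a

<ᵇ-irrefl : ∀ m → ¬ T (m <ᵇ m)
<ᵇ-irrefl m m<m = <-irrefl refl (<ᵇ⇒< m m m<m)

𝟙 : Bool → ℕ
𝟙 b = if b then 1 else 0

𝟙-mono-≤ : ∀ a b → (T a → T b) → 𝟙 a ≤ 𝟙 b
𝟙-mono-≤ false _    _   = z≤n
𝟙-mono-≤ true  true _   = ≤-refl
𝟙-mono-≤ true  false a⇒b = ⊥-elim (a⇒b tt)

𝟙-mono-< : ∀ a b → ¬ T a → T b → 𝟙 a < 𝟙 b
𝟙-mono-< false true _  _ = s≤s z≤n
𝟙-mono-< true  _    ¬a _ = ⊥-elim (¬a tt)

𝟙-⊆-∪ : ∀ a b c → (T a → T b ⊎ T c) → 𝟙 a ≤ 𝟙 b + 𝟙 c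
𝟙-⊆-∪ false _     _    _ = z≤n
𝟙-⊆-∪ true  true  _    _ = s≤s z≤n
𝟙-⊆-∪ true  false true _ = s≤s z≤n
𝟙-⊆-∪ true  false false a⇒b∨c with a⇒b∨c tt
... | inj₁ ()
... | inj₂ ()

𝟙-disjoint-∪ : ∀ a b c → (T a ⇔ (T b ⊎ T c)) → (T b → ¬ T c) → 𝟙 a ≡ 𝟙 b + 𝟙 c
𝟙-disjoint-∪ false false false _   _        = refl
𝟙-disjoint-∪ true  true  false _   _        = refl
𝟙-disjoint-∪ true  false true  _   _        = refl
𝟙-disjoint-∪ _     true  true  _   disjoint = ⊥-elim (disjoint tt tt)
𝟙-disjoint-∪ false true  false a⇔b∨c _      = ⊥-elim (Equivalence.from a⇔b∨c (inj₁ tt))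
𝟙-disjoint-∪ false false true  a⇔b∨c _      = ⊥-elim (Equivalence.from a⇔b∨c (inj₂ tt))
𝟙-disjoint-∪ true  false false a⇔b∨c _      with Equivalence.to a⇔b∨c tt
... | inj₁ ()
... | inj₂ ()

count-all : ∀ n → count {n} (λ _ → true) ≡ n
count-all zero    = refl
count-all (suc n) = cong suc (count-all n)

module _ {n : ℕ} where

  count-mono-≤ : {P Q : Fin n → Bool} → (∀ x → T (P x) → T (Q x)) → count P ≤ count Q
  count-mono-≤ {P} {Q} P⊆Q = Σ-mono-≤ n (λ x → 𝟙-mono-≤ (P x) (Q x) (P⊆Q x))

  count-mono-< : {P Q : Fin n → Bool} → (∀ x → T (P x) → T (Q x)) →
                 ∀ x → ¬ T (P x) → T (Q x) → count P < count Q
  count-mono-< {P} {Q} P⊆Q x ¬Px Qx =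
    Σ-mono-< n (λ y → 𝟙-mono-≤ (P y) (Q y) (P⊆Q y)) x (𝟙-mono-< (P x) (Q x) ¬Px Qx)

  count-⊆-∪ : {P Q R : Fin n → Bool} → (∀ x → T (P x) → T (Q x) ⊎ T (R x)) →
              count P ≤ count Q + count R
  count-⊆-∪ {P} {Q} {R} P⊆Q∪R = ≤-trans
    (Σ-mono-≤ n (λ x → 𝟙-⊆-∪ (P x) (Q x) (R x) (P⊆Q∪R x)))
    (≤-reflexive (Σ-distrib-+ n (𝟙 ∘ Q) (𝟙 ∘ R)))

  count-disjoint-∪ : {P Q R : Fin n → Bool} → (∀ x → T (P x) ⇔ (T (Q x) ⊎ T (R x))) →
                     (∀ x → T (Q x) → ¬ T (R x)) → count P ≡ count Q + count R
  count-disjoint-∪ {P} {Q} {R} P⇔Q∪R disjoint = trans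
    (Σ-cong n (λ x → 𝟙-disjoint-∪ (P x) (Q x) (R x) (P⇔Q∪R x) (disjoint x)))
    (Σ-distrib-+ n (𝟙 ∘ Q) (𝟙 ∘ R))

injective⇒strictlySurjective : ∀ {n} {f : Fin n → Fin n} → Injective _≡_ _≡_ f → StrictlySurjective _≡_ f
injective⇒strictlySurjective {suc m} {f} f-inj j with FP.any? (λ i → f i F.≟ j)
... | yes hit  = hit
... | no ¬hit  =
  let i₁ , i₂ , i₁<i₂ , same = FP.pigeonhole (n<1+n m) (λ i → F.punchOut {i = j} (λ fi≡j → ¬hit (i , sym fi≡j)))
  in  contradiction (f-inj (FP.punchOut-injective {i = j} {j = f i₁} {k = f i₂} _ _ same)) (FP.<⇒≢ i₁<i₂)

n<2*m⇒⌊n/2⌋<m : ∀ n m → n < 2 * m → ⌊ n /2⌋ < m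
n<2*m⇒⌊n/2⌋<m n m n<2m = decidable-stable (⌊ n /2⌋ <? m) λ ⌊n/2⌋≮m →
  let m≤⌊n/2⌋ = ≮⇒≥ ⌊n/2⌋≮m in
  <⇒≱ n<2m (begin
    2 * m                ≡⟨ cong (m +_) (+-identityʳ m) ⟩
    m + m                ≤⟨ +-mono-≤ m≤⌊n/2⌋ (≤-trans m≤⌊n/2⌋ (⌊n/2⌋≤⌈n/2⌉ n)) ⟩
    ⌊ n /2⌋ + ⌈ n /2⌉    ≡⟨ ⌊n/2⌋+⌈n/2⌉≡n n ⟩
    n                    ∎)
  where open ≤-Reasoning

n<2^[1+k]⇒⌊log₂n⌋≤k : ∀ k n → n < 2 ^ suc k → ⌊log₂ n ⌋ ≤ k
n<2^[1+k]⇒⌊log₂n⌋≤k zero    0             _ = z≤n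
n<2^[1+k]⇒⌊log₂n⌋≤k zero    1             _ = z≤n
n<2^[1+k]⇒⌊log₂n⌋≤k zero    (suc (suc n)) (s≤s (s≤s ()))
n<2^[1+k]⇒⌊log₂n⌋≤k (suc k) n n<2^[2+k] = begin
  ⌊log₂ n ⌋                ≤⟨ m≤n+m∸n ⌊log₂ n ⌋ 1 ⟩
  suc (⌊log₂ n ⌋ ∸ 1)      ≡⟨ cong suc (⌊log₂⌊n/2⌋⌋≡⌊log₂n⌋∸1 n) ⟨
  suc ⌊log₂ ⌊ n /2⌋ ⌋      ≤⟨ s≤s (n<2^[1+k]⇒⌊log₂n⌋≤k k ⌊ n /2⌋ (n<2*m⇒⌊n/2⌋<m n _ n<2^[2+k])) ⟩
  suc k                    ∎
  where open ≤-Reasoning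

n<2^[1+⌊log₂n⌋] : ∀ n → n < 2 ^ suc ⌊log₂ n ⌋
n<2^[1+⌊log₂n⌋] n = decidable-stable (n <? 2 ^ suc ⌊log₂ n ⌋) λ n≮ →
  <-irrefl refl (begin-strict
    ⌊log₂ n ⌋                      <⟨ n<1+n _ ⟩
    suc ⌊log₂ n ⌋                  ≡⟨ ⌊log₂[2^n]⌋≡n (suc ⌊log₂ n ⌋) ⟨
    ⌊log₂ (2 ^ suc ⌊log₂ n ⌋) ⌋    ≤⟨ ⌊log₂⌋-mono-≤ (≮⇒≥ n≮) ⟩
    ⌊log₂ n ⌋                      ∎)
  where open ≤-Reasoning

⌊log₂n⌋≡k : ∀ k n → 2 ^ k ≤ n → n < 2 ^ suc k → ⌊log₂ n ⌋ ≡ k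
⌊log₂n⌋≡k k n 2^k≤n n<2^[1+k] = ≤-antisym
  (n<2^[1+k]⇒⌊log₂n⌋≤k k n n<2^[1+k])
  (subst (_≤ ⌊log₂ n ⌋) (⌊log₂[2^n]⌋≡n k) (⌊log₂⌋-mono-≤ 2^k≤n))

minOver-≤ : ∀ {n} (R : Subset n) (f : Fin n → ℕ) {x} → x ∈ R → ∃ λ m → minOver R f ≡ just m × m ≤ f x
minOver-≤ (_ ∷ R) f here with minOver R (f ∘ F.suc)
... | nothing = f F.zero , refl , ≤-refl
... | just m  = f F.zero ⊓ m , refl , m⊓n≤m _ _
minOver-≤ (b ∷ R) f (there x∈R) with minOver R (f ∘ F.suc) | minOver-≤ R (f ∘ F.suc) x∈R
minOver-≤ (true  ∷ R) f (there x∈R) | just m | .m , refl , m≤fx = f F.zero ⊓ m , refl , ≤-trans (m⊓n≤n _ _) m≤fx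
minOver-≤ (false ∷ R) f (there x∈R) | just m | .m , refl , m≤fx = m , refl , m≤fx

minOver-attained : ∀ {n} (R : Subset n) (f : Fin n → ℕ) {m} → minOver R f ≡ just m → ∃ λ x → x ∈ R × f x ≡ m
minOver-attained (b ∷ R) f eq with minOver R (f ∘ F.suc) in eq′
minOver-attained (true ∷ R) f refl | nothing = F.zero , here , refl
minOver-attained (true ∷ R) f refl | just m with ⊓-sel (f F.zero) m
... | inj₁ f0⊓m≡f0 = F.zero , here , sym f0⊓m≡f0
... | inj₂ f0⊓m≡m  = let x , x∈R , fx≡m = minOver-attained R (f ∘ F.suc) eq′
                     in F.suc x , there x∈R , trans fx≡m (sym f0⊓m≡m)
minOver-attained (false ∷ R) f refl | just m =
  let x , x∈R , fx≡m = minOver-attained R (f ∘ F.suc) eq′ in F.suc x , there x∈R , fx≡m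

a<b⇒a*k+i<b*k+j : ∀ {a b k i} j → a < b → i < k → a * k + i < b * k + j
a<b⇒a*k+i<b*k+j {a} {b} {k} {i} j a<b i<k = begin-strict
  a * k + i    <⟨ +-monoʳ-< (a * k) i<k ⟩
  a * k + k    ≡⟨ +-comm (a * k) k ⟩
  suc a * k    ≤⟨ *-monoˡ-≤ k a<b ⟩
  b * k        ≤⟨ m≤m+n (b * k) j ⟩
  b * k + j    ∎
  where open ≤-Reasoning

a*k+i<b*k+j⇒a<b : ∀ {a b k i j} → a * k + i < b * k + j → j ≤ i → a < b
a*k+i<b*k+j⇒a<b {a} {b} {k} a*k+i<b*k+j j≤i = decidable-stable (a <? b) λ a≮b →
  <⇒≱ a*k+i<b*k+j (+-mono-≤ (*-monoˡ-≤ k (≮⇒≥ a≮b)) j≤i)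

a*k+i<b*k+j⇒a≤b : ∀ {a b k i j} → a * k + i < b * k + j → j < k → a ≤ b
a*k+i<b*k+j⇒a≤b {a} {b} {k} {i} a*k+i<b*k+j j<k = decidable-stable (a ≤? b) λ a≰b →
  <-asym a*k+i<b*k+j (a<b⇒a*k+i<b*k+j i (≰⇒> a≰b) j<k)

a*k+i≡b*k+j⇒a≡b : ∀ {a b k i j} → a * k + i ≡ b * k + j → i < k → j < k → a ≡ b
a*k+i≡b*k+j⇒a≡b eq i<k j<k = ≤-antisym
  (≮⇒≥ λ b<a → <⇒≢ (a<b⇒a*k+i<b*k+j _ b<a j<k) (sym eq))
  (≮⇒≥ λ a<b → <⇒≢ (a<b⇒a*k+i<b*k+j _ a<b i<k) eq)

module SortBy {n} (key : Fin n → ℕ) (key-injective : Injective _≡_ _≡_ key) where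

  position : Fin n → ℕ
  position x = count (λ y → key y <ᵇ key x)

  position-mono-< : ∀ {x y} → key x < key y → position x < position y
  position-mono-< {x} {y} kx<ky = count-mono-<
    (λ z kz<kx → <⇒<ᵇ (<-trans (<ᵇ⇒< (key z) (key x) kz<kx) kx<ky)) x (<ᵇ-irrefl (key x)) (<⇒<ᵇ kx<ky)

  position<n : ∀ x → position x < n
  position<n x = subst (position x <_) (count-all n) (count-mono-< (λ _ _ → tt) x (<ᵇ-irrefl (key x)) tt)

  position-injective : Injective _≡_ _≡_ position
  position-injective {x} {y} eq with <-cmp (key x) (key y)
  ... | tri< kx<ky _ _ = contradiction eq (<⇒≢ (position-mono-< kx<ky))
  ... | tri≈ _ kx≡ky _ = key-injective kx≡ky
  ... | tri> _ _ ky<kx = contradiction (sym eq) (<⇒≢ (position-mono-< ky<kx))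

  position-cancel-< : ∀ {x y} → position x < position y → key x < key y
  position-cancel-< {x} {y} px<py with <-cmp (key x) (key y)
  ... | tri< kx<ky _ _ = kx<ky
  ... | tri≈ _ kx≡ky _ = contradiction (cong position (key-injective kx≡ky)) (<⇒≢ px<py)
  ... | tri> _ _ ky<kx = contradiction (position-mono-< ky<kx) (<-asym px<py)

  sorted : Perm n
  sorted = mk⤖ (to-injective , strictlySurjective⇒surjective (injective⇒strictlySurjective to-injective))
    where
    to : Fin n → Fin n
    to x = fromℕ< (position<n x)
    to-injective : Injective _≡_ _≡_ to
    to-injective {x} {y} eq = position-injective (begin
      position x             ≡⟨ FP.toℕ-fromℕ< (position<n x) ⟨
      toℕ (to x)             ≡⟨ cong toℕ eq ⟩
      toℕ (to y)             ≡⟨ FP.toℕ-fromℕ< (position<n y) ⟩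
      position y             ∎)
      where open ≡-Reasoning

  rank-sorted : ∀ x → rank sorted x ≡ suc (position x)
  rank-sorted x = cong suc (FP.toℕ-fromℕ< (position<n x))

countBelow : ∀ {n w} → Partitioning n w → ℕ → ℕ
countBelow p k = count (λ x → toℕ (p x) <ᵇ k)

1+countBelow≡2^ : ∀ {n w} {p : Partitioning n w} → Valid p → ∀ k → k ≤ w → suc (countBelow p k) ≡ 2 ^ k
1+countBelow≡2^ {n} valid zero _ = cong suc (Σ-zero n)
1+countBelow≡2^ {n} {p = p} valid (suc k) k<w = begin
  suc (countBelow p (suc k))           ≡⟨ cong suc (count-disjoint-∪ {P = below (suc k)} split disjoint) ⟩
  suc (countBelow p k) + count at-i    ≡⟨ cong₂ _+_ (1+countBelow≡2^ {p = p} valid k (<⇒≤ k<w)) (valid i) ⟩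
  2 ^ k + 2 ^ toℕ i                    ≡⟨ cong (λ j → 2 ^ k + 2 ^ j) (FP.toℕ-fromℕ< k<w) ⟩
  2 ^ k + 2 ^ k                        ≡⟨ cong (2 ^ k +_) (+-identityʳ (2 ^ k)) ⟨
  2 ^ suc k                            ∎
  where
  open ≡-Reasoning
  i : Fin _
  i = fromℕ< k<w
  below : ℕ → Fin n → Bool
  below j x = toℕ (p x) <ᵇ j
  at-i : Fin n → Bool
  at-i x = does (p x F.≟ i)
  at-i⇒level≡k : ∀ x → T (at-i x) → toℕ (p x) ≡ k
  at-i⇒level≡k x px≡i = trans (cong toℕ (does-sound (p x F.≟ i) px≡i)) (FP.toℕ-fromℕ< k<w)
  level≡k⇒at-i : ∀ x → toℕ (p x) ≡ k → T (at-i x)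
  level≡k⇒at-i x px≡k = does-complete (p x F.≟ i) (FP.toℕ-injective (trans px≡k (sym (FP.toℕ-fromℕ< k<w))))
  split : ∀ x → T (below (suc k) x) ⇔ (T (below k x) ⊎ T (at-i x))
  split x = mk⇔
    (λ px<1+k → Sum.map <⇒<ᵇ (level≡k⇒at-i x) (m≤n⇒m<n∨m≡n (s≤s⁻¹ (<ᵇ⇒< (toℕ (p x)) (suc k) px<1+k))))
    [ (λ px<k → <⇒<ᵇ (m<n⇒m<1+n (<ᵇ⇒< (toℕ (p x)) k px<k)))
    , (λ px≡i → <⇒<ᵇ (≤-reflexive (cong suc (at-i⇒level≡k x px≡i))))
    ]
  disjoint : ∀ x → T (below k x) → ¬ T (at-i x)
  disjoint x px<k px≡i = <-irrefl (at-i⇒level≡k x px≡i) (<ᵇ⇒< (toℕ (p x)) k px<k)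

countBelow<2^ : ∀ {n w} {p : Partitioning n w} → Valid p → ∀ k → k ≤ w → countBelow p k < 2 ^ k
countBelow<2^ {p = p} valid k k≤w = ≤-reflexive (1+countBelow≡2^ {p = p} valid k k≤w)

module SortByLevel {n w} (π₀ : Perm n) (p₁ : Partitioning n w) (p₁-valid : Valid p₁) where

  level order₀ : Fin n → ℕ
  level x = toℕ (p₁ x)
  order₀ x = toℕ (Bijection.to π₀ x)

  key : Fin n → ℕ
  key x = level x * n + order₀ x

  level-<⇒key-< : ∀ {x y} → level x < level y → key x < key y
  level-<⇒key-< {x} {y} lx<ly = a<b⇒a*k+i<b*k+j (order₀ y) lx<ly (FP.toℕ<n _)

  key-<⇒level-≤ : ∀ {x y} → key x < key y → level x ≤ level y
  key-<⇒level-≤ {x} {y} kx<ky = a*k+i<b*k+j⇒a≤b {level x} {level y} {n} {order₀ x} kx<ky (FP.toℕ<n _)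

  key-<⇒level-< : ∀ {x y} → key x < key y → order₀ y ≤ order₀ x → level x < level y
  key-<⇒level-< {x} {y} = a*k+i<b*k+j⇒a<b {level x} {level y} {n}

  key-injective : Injective _≡_ _≡_ key
  key-injective {x} {y} eq = Bijection.injective π₀ (FP.toℕ-injective (+-cancelˡ-≡ (level x * n) _ _ (begin
      level x * n + order₀ x   ≡⟨ eq ⟩
      level y * n + order₀ y   ≡⟨ cong (λ l → l * n + order₀ y) ly≡lx ⟩
      level x * n + order₀ y   ∎)))
    where
    open ≡-Reasoning
    ly≡lx : level y ≡ level x
    ly≡lx = sym (a*k+i≡b*k+j⇒a≡b {level x} {level y} {n} eq (FP.toℕ<n _) (FP.toℕ<n _))

  open SortBy key key-injective public

  cp-sorted : ∀ x → cpℕ sorted x ≡ level x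
  cp-sorted x = begin
    ⌊log₂ rank sorted x ⌋     ≡⟨ cong ⌊log₂_⌋ (rank-sorted x) ⟩
    ⌊log₂ suc (position x) ⌋  ≡⟨ ⌊log₂n⌋≡k (level x) _ lower upper ⟩
    level x                   ∎
    where
    open ≡-Reasoning
    lower : 2 ^ level x ≤ suc (position x)
    lower = subst (_≤ suc (position x)) (1+countBelow≡2^ {p = p₁} p₁-valid (level x) (<⇒≤ (FP.toℕ<n (p₁ x))))
      (s≤s (count-mono-≤ λ y ly<lx → <⇒<ᵇ (level-<⇒key-< (<ᵇ⇒< (level y) (level x) ly<lx))))
    upper : suc (position x) < 2 ^ suc (level x)
    upper = subst (suc (position x) <_) (1+countBelow≡2^ {p = p₁} p₁-valid (suc (level x)) (FP.toℕ<n (p₁ x)))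
      (s≤s (count-mono-< (λ y ky<kx → <⇒<ᵇ (s≤s (key-<⇒level-≤ (<ᵇ⇒< (key y) (key x) ky<kx))))
        x (<ᵇ-irrefl (key x)) (<⇒<ᵇ (n<1+n (level x)))))

  inversion⇒level-< : ∀ {x y} → rank π₀ x < rank π₀ y → rank sorted y < rank sorted x → level y < level x
  inversion⇒level-< {x} {y} π₀x<π₀y sy<sx = key-<⇒level-< ky<kx (<⇒≤ (s≤s⁻¹ π₀x<π₀y))
    where
    ky<kx : key y < key x
    ky<kx = position-cancel-< (s≤s⁻¹ (subst₂ _<_ (rank-sorted y) (rank-sorted x) sy<sx))

q≤t∧r≤2s⇒q+r≤3[s⊔t] : ∀ {q r s t} → q ≤ t → r ≤ 2 * s → q + r ≤ 3 * (s ⊔ t)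
q≤t∧r≤2s⇒q+r≤3[s⊔t] {q} {r} {s} {t} q≤t r≤2s = begin
  q + r                          ≤⟨ +-mono-≤ (≤-trans q≤t (m≤n⊔m s t)) (≤-trans r≤2s (*-monoʳ-≤ 2 (m≤m⊔n s t))) ⟩
  (s ⊔ t) + 2 * (s ⊔ t)          ≡⟨⟩
  3 * (s ⊔ t)                    ∎
  where open ≤-Reasoning

module Charging {n w} (π₀ : Perm n) (p₀ p₁ : Partitioning n w)
  (p₀-canonic : ∀ x → toℕ (p₀ x) ≡ cpℕ π₀ x) (p₁-valid : Valid p₁) where

  open SortByLevel π₀ p₁ p₁-valid

  moved : Fin n → Bool
  moved x = not (does (p₁ x F.≟ p₀ x))

  chargedUp chargedDown : Fin n → Fin n → Bool
  chargedUp   x y = moved x ∧ (level y <ᵇ level x)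
  chargedDown x y = moved x ∧ (level y <ᵇ suc (toℕ (p₀ x)))

  p₀-mono : ∀ {x y} → rank π₀ x ≤ rank π₀ y → toℕ (p₀ x) ≤ toℕ (p₀ y)
  p₀-mono {x} {y} le = subst₂ _≤_ (sym (p₀-canonic x)) (sym (p₀-canonic y)) (⌊log₂⌋-mono-≤ le)

  inversion-charged : ∀ x y → T (discordant π₀ sorted x y) → T (chargedUp x y) ⊎ T (chargedDown y x)
  inversion-charged x y inv = charge (p₁ x F.≟ p₀ x) (p₁ y F.≟ p₀ y)
    where
    π₀x<π₀y : rank π₀ x < rank π₀ y
    π₀x<π₀y = does-sound (rank π₀ x <? rank π₀ y) (proj₁ (Equivalence.to T-∧ inv))
    ly<lx : level y < level x
    ly<lx = inversion⇒level-< π₀x<π₀y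
      (does-sound (rank sorted y <? rank sorted x) (proj₂ (Equivalence.to T-∧ inv)))
    p₀x≤p₀y : toℕ (p₀ x) ≤ toℕ (p₀ y)
    p₀x≤p₀y = p₀-mono (<⇒≤ π₀x<π₀y)
    charge : (x? : Dec (p₁ x ≡ p₀ x)) (y? : Dec (p₁ y ≡ p₀ y)) →
      T (not (does x?) ∧ (level y <ᵇ level x)) ⊎ T (not (does y?) ∧ (level x <ᵇ suc (toℕ (p₀ y))))
    charge (no _)         _              = inj₁ (<⇒<ᵇ ly<lx)
    charge (yes x-stays)  (no _)         =
      inj₂ (<⇒<ᵇ (s≤s (subst (_≤ toℕ (p₀ y)) (cong toℕ (sym x-stays)) p₀x≤p₀y)))
    charge (yes x-stays)  (yes y-stays)  =
      contradiction ly<lx (≤⇒≯ (subst₂ _≤_ (cong toℕ (sym x-stays)) (cong toℕ (sym y-stays)) p₀x≤p₀y))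

  cost : Fin n → ℕ
  cost x = if does (p₁ x F.≟ p₀ x) then 0 else (size p₀ x ⊔ size p₁ x)

  charges≤3*cost : ∀ x → count (chargedUp x) + count (chargedDown x) ≤ 3 * cost x
  charges≤3*cost x with does (p₁ x F.≟ p₀ x)
  ... | true  = ≤-reflexive (cong₂ _+_ (Σ-zero n) (Σ-zero n))
  ... | false = q≤t∧r≤2s⇒q+r≤3[s⊔t] {s = size p₀ x}
    (<⇒≤ (countBelow<2^ {p = p₁} p₁-valid (level x) (<⇒≤ (FP.toℕ<n (p₁ x)))))
    (<⇒≤ (countBelow<2^ {p = p₁} p₁-valid (suc (toℕ (p₀ x))) (FP.toℕ<n (p₀ x))))

  dist≤3*moveCost : dist π₀ sorted ≤ 3 * moveCost p₀ p₁
  dist≤3*moveCost = begin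
    dist π₀ sorted
      ≤⟨ Σ-mono-≤ n (λ x → count-⊆-∪ (inversion-charged x)) ⟩
    Σ[ n ] (λ x → count (chargedUp x) + count (λ y → chargedDown y x))
      ≡⟨ Σ-distrib-+ n _ _ ⟩
    Σ[ n ] (λ x → count (chargedUp x)) + Σ[ n ] (λ x → count (λ y → chargedDown y x))
      ≡⟨ cong (Σ[ n ] (λ x → count (chargedUp x)) +_) (Σ-comm n n (λ x y → 𝟙 (chargedDown y x))) ⟩
    Σ[ n ] (λ x → count (chargedUp x)) + Σ[ n ] (λ x → count (chargedDown x))
      ≡⟨ Σ-distrib-+ n _ _ ⟨
    Σ[ n ] (λ x → count (chargedUp x) + count (chargedDown x))
      ≤⟨ Σ-mono-≤ n charges≤3*cost ⟩
    Σ[ n ] (λ x → 3 * cost x)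
      ≡⟨ *-distribˡ-Σ n 3 cost ⟨
    3 * moveCost p₀ p₁
      ∎
    where open ≤-Reasoning

module _ {n w} {π : Perm n} {p : Partitioning n w} (p-canonic : ∀ x → toℕ (p x) ≡ cpℕ π x) where

  rank<2*size : ∀ x → rank π x < 2 * size p x
  rank<2*size x = subst (λ l → rank π x < 2 * 2 ^ l) (sym (p-canonic x)) (n<2^[1+⌊log₂n⌋] (rank π x))

  minRank<2*minSize : ∀ R {a b} → minOver R (rank π) ≡ just a → minOver R (size p) ≡ just b → a < 2 * b
  minRank<2*minSize R {a} {b} min-rank min-size
    with x , x∈R , size-x≡b ← minOver-attained R (size p) min-size
    with a′ , min-rank′ , a′≤rank-x ← minOver-≤ R (rank π) x∈R
    = begin-strict
    a              ≡⟨ just-injective (trans (sym min-rank) min-rank′) ⟩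
    a′             ≤⟨ a′≤rank-x ⟩
    rank π x       <⟨ rank<2*size x ⟩
    2 * size p x   ≡⟨ cong (2 *_) size-x≡b ⟩
    2 * b          ∎
    where open ≤-Reasoning

lemma1 : (w : ℕ) → (π₀ : Perm (2 ^ w ∸ 1)) → (p₀ p₁ : Partitioning (2 ^ w ∸ 1) w)
  → (∀ x → toℕ (p₀ x) ≡ cpℕ π₀ x)
  → Valid p₁
  → (R : Subset (2 ^ w ∸ 1)) → Nonempty R
  → Σ (Perm (2 ^ w ∸ 1)) (λ π₁ →
      (∀ x → cpℕ π₁ x ≡ toℕ (p₁ x))
      × (∀ a b → minOver R (rank π₀) ≡ just a → minOver R (size p₀) ≡ just b
           → a + dist π₀ π₁ ≤ 4 * (b + moveCost p₀ p₁)))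
lemma1 w π₀ p₀ p₁ p₀-canonic p₁-valid R _ = sorted , cp-sorted , cost-bound
  where
  open SortByLevel π₀ p₁ p₁-valid using (sorted; cp-sorted)
  open Charging π₀ p₀ p₁ p₀-canonic p₁-valid using (dist≤3*moveCost)
  cost-bound : ∀ a b → minOver R (rank π₀) ≡ just a → minOver R (size p₀) ≡ just b
             → a + dist π₀ sorted ≤ 4 * (b + moveCost p₀ p₁)
  cost-bound a b min-rank min-size = begin
    a + dist π₀ sorted           ≤⟨ +-mono-≤ (<⇒≤ a<2b) dist≤3*moveCost ⟩
    2 * b + 3 * moveCost p₀ p₁   ≤⟨ +-mono-≤ (*-monoˡ-≤ b {2} {4} (s≤s (s≤s z≤n)))
                                             (*-monoˡ-≤ (moveCost p₀ p₁) {3} {4} (s≤s (s≤s (s≤s z≤n)))) ⟩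
    4 * b + 4 * moveCost p₀ p₁   ≡⟨ *-distribˡ-+ 4 b (moveCost p₀ p₁) ⟨
    4 * (b + moveCost p₀ p₁)     ∎
    where
    open ≤-Reasoning
    a<2b : a < 2 * b
    a<2b = minRank<2*minSize {π = π₀} {p = p₀} p₀-canonic R min-rank min-size
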